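{- Suppose $\Delta,n\in \mathbb{N}$ with $1/n \ll \beta \ll \alpha\leq 1/\Delta$ and $c\in \{1,2\}$. Let $\mathcal{F}$ be a collection of forests such that (i) each $F\in \mathcal{F}$ consists of two components $K_F^1, K_F^2$; (ii) $K_F^i$ has a root $x_F^i$ for every $i\in [2]$ and every $F\in \mathcal{F}$; (iii) $|K_F^1|, |K_F^2|\geq \alpha n$; (iv) $|F|\leq n$ and $\Delta(F)\leq \Delta$. Then for every $F\in \mathcal{F}$ there exists a subforest $T_F$ of $F$ such that (I) $T_F$ consists of $c$ components $T_F^1,\dots,T_F^c$; (II) for each $i\in [c]$, $T_F^i=K^i_F(y_F^i)$ for some $y_F^i\in V(K_F^i)$, and in particular $F-V(T_F)$ is a forest consisting of two components; (III) $T_F$ has distance at least $5$ from $\{x_F^1, x_F^2\}$; (IV) $\Delta^{ -1} \beta n/2 \leq |T_F^{i}|\leq \Delta\beta n$ for all $F\in \mathcal{F}$ and $i\in [c]$; and (V) $\sum_{F\in \mathcal{F}} e(T_F) = \beta n |\mathcal{F}| \pm n$.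
   Context: For a tree $K$ rooted at $x$ and $v\in V(K)$, $K(v)$ is the subtree induced by all vertices $u$ whose path to $x$ contains $v$ (including $v$). $a=b\pm c$ means $b-c\le a\le b+c$. Hierarchy convention: there are non-decreasing functions $f,g$ such that the statement holds whenever $\beta\le f(\alpha)$ and $1/n\le g(\beta)$. -}

module Defs where

open import Data.Nat as ℕ using (ℕ; zero; suc; _+_; _∸_)
open import Data.Integer using (+_)
open import Data.Rational as ℚ using (ℚ; _/_; _≤_; _<_; 0ℚ)
open import Data.List using (List; []; _∷_; length; map; allFin)
open import Data.Nat.ListAction using (sum)
open import Data.Fin using (Fin)
open import Data.Maybe using (Maybe; just; nothing)
open import Data.Product using (_×_)

-- Rooted trees (finite, ordered rose trees).  The root is the outer
-- 'node'; vertices are addressed by positions = lists of child indices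
-- (the root is the empty position).

data Tree : Set where
  node : List Tree → Tree

children : Tree → List Tree
children (node ts) = ts

mutual
  size : Tree → ℕ
  size (node ts) = suc (sizes ts)

  sizes : List Tree → ℕ
  sizes []       = 0
  sizes (t ∷ ts) = size t + sizes ts

edges : Tree → ℕ
edges t = size t ∸ 1

Pos : Set
Pos = List ℕ

-- K at p = just (K(p)), the subtree rooted at vertex p (all vertices whose
-- path to the root passes through p); nothing if p is not a vertex of K.
mutual
  _at_ : Tree → Pos → Maybe Tree
  t at []            = just t
  node ts at (k ∷ p) = atList ts k p

  atList : List Tree → ℕ → Pos → Maybe Tree
  atList []       _       _ = nothing
  atList (t ∷ ts) zero    p = t at p
  atList (t ∷ ts) (suc k) p = atList ts k p

-- degree of the vertex at position p (whose subtree is s) in K: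
-- number of children, plus one for the parent edge unless p is the root
isRootPos : Pos → ℕ
isRootPos []      = 0
isRootPos (_ ∷ _) = 1

degAt : Pos → Tree → ℕ
degAt p s = length (children s) + isRootPos p

MaxDeg≤ : Tree → ℕ → Set
MaxDeg≤ K D = ∀ (p : Pos) (s : Tree) → K at p ≡ just s → degAt p s ℕ.≤ D
  where open import Relation.Binary.PropositionalEquality using (_≡_)

distRoot : Pos → ℕ
distRoot p = length p

-- the subtree K(y) has distance at least d from the root of K:
-- every vertex of K(y) (i.e. every vertex at a position y ++ q) is at
-- distance ≥ d from the root.
FarFromRoot : ℕ → Tree → Pos → Set
FarFromRoot d K y = ∀ (q : Pos) (s : Tree) → K at (y Data.List.++ q) ≡ just s
                    → d ℕ.≤ distRoot (y Data.List.++ q)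
  where open import Relation.Binary.PropositionalEquality using (_≡_)
        import Data.List

-- Forests consisting of two rooted components K¹, K² (roots x¹, x²).

record Forest : Set where
  constructor forest
  field
    K₁ : Tree
    K₂ : Tree

-- component i ∈ {0,1} (i.e. K^{i+1}); only used with i < 2
comp : Forest → ℕ → Tree
comp F zero    = Forest.K₁ F
comp F (suc _) = Forest.K₂ F

order : Forest → ℕ
order F = size (Forest.K₁ F) + size (Forest.K₂ F)

MaxDegF≤ : Forest → ℕ → Set
MaxDegF≤ F D = MaxDeg≤ (Forest.K₁ F) D × MaxDeg≤ (Forest.K₂ F) D

ℕ→ℚ : ℕ → ℚ
ℕ→ℚ n = + n / 1

_≈_±_ : ℚ → ℚ → ℚ → Set
a ≈ b ± c = (b ℚ.- c ≤ a) × (a ≤ b ℚ.+ c)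

∑ : (N : ℕ) → (Fin N → ℕ) → ℕ
∑ N f = sum (map f (allFin N))

-- hierarchy functions: non-decreasing, positive on positive inputs
NonDecreasing : (ℚ → ℚ) → Set
NonDecreasing f = ∀ x y → x ≤ y → f x ≤ f y

PositiveOnPositive : (ℚ → ℚ) → Set
PositiveOnPositive f = ∀ x → 0ℚ < x → 0ℚ < f x

-- Write m = ⌈βn⌉ − 1 and L = ⌊m/c⌋, so that cL ≤ m < βn ≤ m + 1 ≤ c(L + 1). In a rooted tree of maximum
-- degree Δ with more than (Δ+1)⁵(L+1) vertices, walking down along largest children reaches depth 5 inside a
-- subtree with more than L + 1 vertices; walking on, we meet a vertex y with |K(y)| > L + 1 all of whose children z
-- have |K(z)| ≤ L + 1, and |K(y)| ≤ 1 + (Δ − 1)|K(z)| for the largest of them. Taking K(y), resp. K(z), in each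
-- of the c components gives for every forest a heavy option with more than m edges and a light option with at
-- most cL ≤ m edges, i.e. one option on each side of βn, and choosing greedily forest by forest keeps the total
-- within n of βn|𝓕|. Every candidate has between βn/(2Δ) and Δβn vertices. With f(α) = α⁶/64 and g(β) = β²
-- the hypotheses give Δ + 1 ≤ βn ≤ n and (Δ+1)⁵(βn + 1) < αn, which is all the arithmetic needed.

module Submission where

open import Defs

module Subtrees where
  open import Data.Nat using (ℕ; zero; suc; _+_; _*_; _∸_; _^_; _≤_; _<_; s≤s)
  open import Data.Nat.Properties
  open import Data.Bool using (Bool; true; false)
  open import Data.List using ([]; _∷_; length; _++_)
  open import Data.List.Properties using (length-++)
  open import Data.Maybe using (just)
  open import Data.Product using (Σ; _×_; _,_)
  open import Data.Sum using (_⊎_; inj₁; inj₂)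
  open import Data.Empty using (⊥-elim)
  open import Relation.Nullary using (yes; no)
  open import Relation.Binary.PropositionalEquality

  mutual
    at-++ : ∀ K y q {s} → K at y ≡ just s → K at (y ++ q) ≡ s at q
    at-++ K         []      q refl = refl
    at-++ (node ts) (k ∷ y) q eq   = atList-++ ts k y q eq

    atList-++ : ∀ ts k y q {s} → atList ts k y ≡ just s → atList ts k (y ++ q) ≡ s at q
    atList-++ []       k       y q ()
    atList-++ (t ∷ ts) zero    y q eq = at-++ t y q eq
    atList-++ (t ∷ ts) (suc k) y q eq = atList-++ ts k y q eq

  at-trans : ∀ K y q {s t} → K at y ≡ just s → s at q ≡ just t → K at (y ++ q) ≡ just t
  at-trans K y q Ky Sq = trans (at-++ K y q Ky) Sq

  mutual
    size-at : ∀ K p {s} → K at p ≡ just s → size s ≤ size K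
    size-at K         []      refl = ≤-refl
    size-at (node ts) (k ∷ p) eq   = m≤n⇒m≤1+n (size-atList ts k p eq)

    size-atList : ∀ ts k p {s} → atList ts k p ≡ just s → size s ≤ sizes ts
    size-atList []       k       p ()
    size-atList (t ∷ ts) zero    p eq = ≤-trans (size-at t p eq) (m≤m+n (size t) (sizes ts))
    size-atList (t ∷ ts) (suc k) p eq = ≤-trans (size-atList ts k p eq) (m≤n+m (sizes ts) (size t))

  FarFromRoot-++ : ∀ {r} K y p → r ≤ length y → FarFromRoot r K (y ++ p)
  FarFromRoot-++ {r} K y p r≤y q _ _ = begin
    r                          ≤⟨ r≤y ⟩
    length y                   ≤⟨ m≤m+n (length y) (length p) ⟩
    length y + length p        ≡⟨ length-++ y ⟨
    length (y ++ p)            ≤⟨ m≤m+n _ (length q) ⟩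
    length (y ++ p) + length q ≡⟨ length-++ (y ++ p) ⟨
    length ((y ++ p) ++ q)     ∎
    where open ≤-Reasoning

  Branching≤ : ℕ → Tree → Set
  Branching≤ D K = ∀ p s → K at p ≡ just s → length (children s) ≤ D

  Branching≤-at : ∀ {D K} y {s} → Branching≤ D K → K at y ≡ just s → Branching≤ D s
  Branching≤-at {K = K} y h Ky p t St = h (y ++ p) t (at-trans K y p Ky St)

  MaxDeg≤⇒Branching≤ : ∀ {K D} → MaxDeg≤ K D → Branching≤ D K
  MaxDeg≤⇒Branching≤ h p s Kp = ≤-trans (m≤m+n _ _) (h p s Kp)

  -- below the root every vertex also has its parent as a neighbour
  MaxDeg≤⇒Branching≤-below : ∀ {K D} x y {s} → MaxDeg≤ K D → K at (x ∷ y) ≡ just s → Branching≤ (D ∸ 1) s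
  MaxDeg≤⇒Branching≤-below {K} {D} x y h Ks p t St = begin
    length (children t)           ≡⟨ m+n∸n≡m (length (children t)) 1 ⟨
    length (children t) + 1 ∸ 1   ≤⟨ ∸-monoˡ-≤ 1 (h (x ∷ y ++ p) t (at-trans K (x ∷ y) p Ks St)) ⟩
    D ∸ 1                         ∎
    where open ≤-Reasoning

  largest-child : ∀ t ts → Σ ℕ λ k → Σ Tree λ u →
                  node (t ∷ ts) at (k ∷ []) ≡ just u × sizes (t ∷ ts) ≤ length (t ∷ ts) * size u
  largest-child t [] = 0 , t , refl , ≤-reflexive (trans (+-identityʳ (size t)) (sym (*-identityˡ (size t))))
  largest-child t (t′ ∷ ts) with largest-child t′ ts
  ... | k , u , at-u , bound with size t ≤? size u
  ...   | yes t≤u = suc k , u , at-u , +-mono-≤ t≤u bound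
  ...   | no  t≰u = 0 , t , refl , +-monoʳ-≤ (size t)
                      (≤-trans bound (*-monoʳ-≤ (length (t′ ∷ ts)) (<⇒≤ (≰⇒> t≰u))))

  record Straddle (D M : ℕ) (K : Tree) : Set where
    field
      pos             : Bool → Pos
      sub             : Bool → Tree
      at-pos          : ∀ b → K at pos b ≡ just (sub b)
      heavy           : M < size (sub true)
      light           : size (sub false) ≤ M
      heavy≤1+D*light : size (sub true) ≤ suc (D * size (sub false))

  Straddle-at : ∀ {D M} K y {s} → K at y ≡ just s → Straddle D M s → Straddle D M K
  Straddle-at K y Ky S = record
    { pos = λ b → y ++ pos b
    ; sub = sub
    ; at-pos = λ b → at-trans K y (pos b) Ky (at-pos b)
    ; heavy = heavy ; light = light ; heavy≤1+D*light = heavy≤1+D*light }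
    where open Straddle S

  module _ {D M : ℕ} (0<M : 0 < M) where

    large-subtree-at-depth : ∀ r K → Branching≤ D K → suc D ^ r * M < size K →
                             Σ Pos λ y → Σ Tree λ s → length y ≡ r × K at y ≡ just s × M < size s
    large-subtree-at-depth zero K h M<K = [] , K , refl , refl , ≤-<-trans (≤-reflexive (sym (*-identityˡ M))) M<K
    large-subtree-at-depth (suc r) (node []) h big =
      ⊥-elim (<⇒≱ big (*-mono-≤ (m^n>0 (suc D) (suc r)) 0<M))
    large-subtree-at-depth (suc r) (node (t ∷ ts)) h big with largest-child t ts
    ... | k , u , at-u , K≤ with suc D ^ r * M <? size u
    ...   | yes u-big =
            let y , s , ∣y∣ , uy , M<s = large-subtree-at-depth r u (Branching≤-at (k ∷ []) h at-u) u-big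
            in k ∷ y , s , cong suc ∣y∣ , at-trans (node (t ∷ ts)) (k ∷ []) y at-u uy , M<s
    ...   | no  u-small = ⊥-elim (<⇒≱ big K-small)
      where
        X : ℕ
        X = suc D ^ r * M
        K-small : size (node (t ∷ ts)) ≤ suc D ^ suc r * M
        K-small = begin
          suc (sizes (t ∷ ts))            ≤⟨ s≤s K≤ ⟩
          suc (length (t ∷ ts) * size u)  ≤⟨ s≤s (*-mono-≤ (h [] _ refl) (≮⇒≥ u-small)) ⟩
          suc (D * X)                     ≤⟨ +-monoˡ-≤ (D * X) (*-mono-≤ (m^n>0 (suc D) r) 0<M) ⟩
          X + D * X                       ≡⟨ *-assoc (suc D) (suc D ^ r) M ⟨
          suc D ^ suc r * M               ∎
          where open ≤-Reasoning

    -- a heavy vertex all of whose children are light, together with its largest child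
    mutual
      straddle : ∀ s → Branching≤ D s → M < size s → Straddle D M s
      straddle (node ts) h M<s with straddle-in-child ts (λ k → Branching≤-at (k ∷ []) h)
      ... | inj₁ (k , t , at-t , S) = Straddle-at (node ts) (k ∷ []) at-t S
      straddle (node []) h M<s | inj₂ _ = ⊥-elim (<⇒≱ M<s 0<M)
      straddle (node (t ∷ ts)) h M<s | inj₂ children-light with largest-child t ts
      ... | k , u , at-u , K≤ = record
        { pos = λ { true → [] ; false → k ∷ [] }
        ; sub = λ { true → node (t ∷ ts) ; false → u }
        ; at-pos = λ { true → refl ; false → at-u }
        ; heavy = M<s
        ; light = children-light k u at-u
        ; heavy≤1+D*light = s≤s (≤-trans K≤ (*-monoˡ-≤ (size u) (h [] _ refl))) }

      straddle-in-child : ∀ ts → (∀ k {t} → node ts at (k ∷ []) ≡ just t → Branching≤ D t) →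
                          (Σ ℕ λ k → Σ Tree λ t → node ts at (k ∷ []) ≡ just t × Straddle D M t)
                          ⊎ (∀ k t → node ts at (k ∷ []) ≡ just t → size t ≤ M)
      straddle-in-child []       h = inj₂ λ _ _ ()
      straddle-in-child (t ∷ ts) h with M <? size t
      ... | yes M<t = inj₁ (0 , t , refl , straddle t (h 0 refl) M<t)
      ... | no  t≤M with straddle-in-child ts (λ k → h (suc k))
      ...   | inj₁ (k , u , at-u , S) = inj₁ (suc k , u , at-u , S)
      ...   | inj₂ light = inj₂ λ { zero _ refl → ≮⇒≥ t≤M ; (suc k) → light k }

  straddle-far-from-root : ∀ {Δ M} r K → 0 < M → MaxDeg≤ K Δ → suc Δ ^ suc r * M < size K →
                           Σ (Straddle (Δ ∸ 1) M K) λ S → ∀ b → FarFromRoot (suc r) K (Straddle.pos S b)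
  straddle-far-from-root {Δ} {M} r K 0<M h big
    with large-subtree-at-depth 0<M (suc r) K (MaxDeg≤⇒Branching≤ h) big
  ... | x ∷ y , s , ∣y∣ , Ks , M<s =
    Straddle-at K (x ∷ y) Ks S , λ b → FarFromRoot-++ K (x ∷ y) (Straddle.pos S b) (≤-reflexive (sym ∣y∣))
    where
      S : Straddle (Δ ∸ 1) M s
      S = straddle 0<M s (MaxDeg≤⇒Branching≤-below x y h Ks) M<s

  module _ {D M K} (S : Straddle D M K) where
    open Straddle S

    size-sub≤heavy : ∀ b → size (sub b) ≤ size (sub true)
    size-sub≤heavy true  = ≤-refl
    size-sub≤heavy false = <⇒≤ (≤-<-trans light heavy)

    size-sub≤1+D*M : ∀ b → size (sub b) ≤ suc (D * M)
    size-sub≤1+D*M b = ≤-trans (size-sub≤heavy b) (≤-trans heavy≤1+D*light (s≤s (*-monoʳ-≤ D light)))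

    M≤[1+D]*size-sub : ∀ b → M ≤ suc D * size (sub b)
    M≤[1+D]*size-sub true  = ≤-trans (<⇒≤ heavy) (m≤n*m (size (sub true)) (suc D))
    M≤[1+D]*size-sub false = ≤-trans (≤-pred (≤-trans heavy heavy≤1+D*light)) (*-monoˡ-≤ (size (sub false)) (n≤1+n D))

    edges-heavy≤size : edges (sub true) ≤ size K
    edges-heavy≤size = ≤-trans (m∸n≤m _ 1) (size-at K (pos true) (at-pos true))

  module _ {D L K} (S : Straddle D (suc L) K) where
    open Straddle S

    edges-light≤ : edges (sub false) ≤ L
    edges-light≤ = ∸-monoˡ-≤ 1 light

    <edges-heavy : L < edges (sub true)
    <edges-heavy with sub true | heavy
    ... | node _ | s≤s L<s = L<s

module Powers where
  open import Data.Nat using (zero; suc; z≤n; z<s)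
  open import Data.Integer using (+≤+; +<+)
  open import Data.Rational using (_≤_; _<_; _*_; 0ℚ; *≤*; *<*; nonNegative; positive)
  open import Data.Rational.Properties
  open import Algebra.Bundles using (CommutativeRing)
  open import Algebra.Properties.CommutativeSemiring.Exp (CommutativeRing.commutativeSemiring +-*-commutativeRing)
    using (_^_) public

  *-mono-≤-nonNeg : ∀ {p q r s} → 0ℚ ≤ p → 0ℚ ≤ r → p ≤ q → r ≤ s → p * r ≤ q * s
  *-mono-≤-nonNeg {p} {q} {r} {s} 0≤p 0≤r p≤q r≤s =
    ≤-trans (*-monoʳ-≤-nonNeg r {{nonNegative 0≤r}} p≤q) (*-monoˡ-≤-nonNeg q {{nonNegative (≤-trans 0≤p p≤q)}} r≤s)

  *-nonNeg : ∀ {p q} → 0ℚ ≤ p → 0ℚ ≤ q → 0ℚ ≤ p * q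
  *-nonNeg 0≤p 0≤q = *-mono-≤-nonNeg ≤-refl ≤-refl 0≤p 0≤q

  *-pos : ∀ {p q} → 0ℚ < p → 0ℚ < q → 0ℚ < p * q
  *-pos {p} {q} 0<p 0<q = positive⁻¹ (p * q) {{pos*pos⇒pos p {{positive 0<p}} q {{positive 0<q}}}}

  ^-nonNeg : ∀ k {x} → 0ℚ ≤ x → 0ℚ ≤ x ^ k
  ^-nonNeg zero    0≤x = *≤* (+≤+ z≤n)
  ^-nonNeg (suc k) 0≤x = *-nonNeg 0≤x (^-nonNeg k 0≤x)

  ^-pos : ∀ k {x} → 0ℚ < x → 0ℚ < x ^ k
  ^-pos zero    0<x = *<* (+<+ z<s)
  ^-pos (suc k) 0<x = *-pos 0<x (^-pos k 0<x)

  ^-mono-≤ : ∀ k {x y} → 0ℚ ≤ x → x ≤ y → x ^ k ≤ y ^ k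
  ^-mono-≤ zero    0≤x x≤y = ≤-refl
  ^-mono-≤ (suc k) 0≤x x≤y = *-mono-≤-nonNeg 0≤x (^-nonNeg k 0≤x) x≤y (^-mono-≤ k 0≤x x≤y)

module Embedding where
  open import Data.Nat as ℕ using (ℕ; zero; suc)
  import Data.Nat.Properties as ℕ
  open import Data.Integer as ℤ using (+_)
  import Data.Integer.Properties as ℤ
  open import Data.Rational using (mkℚ; _/_; _≤_; _<_; _+_; _*_; 0ℚ; 1ℚ; *≤*; *<*)
  open import Data.Rational.Properties using (normalize-coprime; *-inverseˡ)
  open import Data.Nat.Coprimality using (1-coprimeTo) renaming (sym to coprime-sym)
  open import Relation.Binary.PropositionalEquality
  open Powers using (_^_)

  ℕ→ℚ-mkℚ : ∀ n → ℕ→ℚ n ≡ mkℚ (+ n) 0 (coprime-sym (1-coprimeTo n))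
  ℕ→ℚ-mkℚ n = normalize-coprime (coprime-sym (1-coprimeTo n))

  ℕ→ℚ-+ : ∀ a b → ℕ→ℚ (a ℕ.+ b) ≡ ℕ→ℚ a + ℕ→ℚ b
  ℕ→ℚ-+ a b rewrite ℕ→ℚ-mkℚ a | ℕ→ℚ-mkℚ b =
    cong (_/ 1) (cong₂ ℤ._+_ (sym (ℤ.*-identityʳ (+ a))) (sym (ℤ.*-identityʳ (+ b))))

  ℕ→ℚ-* : ∀ a b → ℕ→ℚ (a ℕ.* b) ≡ ℕ→ℚ a * ℕ→ℚ b
  ℕ→ℚ-* a b rewrite ℕ→ℚ-mkℚ a | ℕ→ℚ-mkℚ b = cong (_/ 1) (ℤ.pos-* a b)

  ℕ→ℚ-^ : ∀ m k → ℕ→ℚ (m ℕ.^ k) ≡ ℕ→ℚ m ^ k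
  ℕ→ℚ-^ m zero    = refl
  ℕ→ℚ-^ m (suc k) = trans (ℕ→ℚ-* m (m ℕ.^ k)) (cong (ℕ→ℚ m *_) (ℕ→ℚ-^ m k))

  ℕ→ℚ-mono-≤ : ∀ {a b} → a ℕ.≤ b → ℕ→ℚ a ≤ ℕ→ℚ b
  ℕ→ℚ-mono-≤ {a} {b} a≤b rewrite ℕ→ℚ-mkℚ a | ℕ→ℚ-mkℚ b = *≤* (ℤ.*-monoʳ-≤-nonNeg (+ 1) (ℤ.+≤+ a≤b))

  ℕ→ℚ-nonNeg : ∀ n → 0ℚ ≤ ℕ→ℚ n
  ℕ→ℚ-nonNeg n = ℕ→ℚ-mono-≤ (ℕ.z≤n {n})

  ℕ→ℚ-cancel-≤ : ∀ {a b} → ℕ→ℚ a ≤ ℕ→ℚ b → a ℕ.≤ b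
  ℕ→ℚ-cancel-≤ {a} {b} le rewrite ℕ→ℚ-mkℚ a | ℕ→ℚ-mkℚ b with le
  ... | *≤* a≤b = ℤ.drop‿+≤+ (subst₂ ℤ._≤_ (ℤ.*-identityʳ (+ a)) (ℤ.*-identityʳ (+ b)) a≤b)

  ℕ→ℚ-mono-< : ∀ {a b} → a ℕ.< b → ℕ→ℚ a < ℕ→ℚ b
  ℕ→ℚ-mono-< {a} {b} a<b rewrite ℕ→ℚ-mkℚ a | ℕ→ℚ-mkℚ b =
    *<* (subst₂ ℤ._<_ (sym (ℤ.*-identityʳ (+ a))) (sym (ℤ.*-identityʳ (+ b))) (ℤ.+<+ a<b))

  ℕ→ℚ-cancel-< : ∀ {a b} → ℕ→ℚ a < ℕ→ℚ b → a ℕ.< b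
  ℕ→ℚ-cancel-< {a} {b} lt rewrite ℕ→ℚ-mkℚ a | ℕ→ℚ-mkℚ b with lt
  ... | *<* a<b = ℤ.drop‿+<+ (subst₂ ℤ._<_ (ℤ.*-identityʳ (+ a)) (ℤ.*-identityʳ (+ b)) a<b)

  1/n*n≡1 : ∀ n .{{_ : ℕ.NonZero n}} → (+ 1 / n) * ℕ→ℚ n ≡ 1ℚ
  1/n*n≡1 (suc d) rewrite ℕ→ℚ-mkℚ (suc d) | normalize-coprime {1} {d} (1-coprimeTo (suc d)) =
    *-inverseˡ (mkℚ (+ suc d) 0 (coprime-sym (1-coprimeTo (suc d))))


module Sums where
  open import Data.Nat using (ℕ; zero; suc; _+_; _*_; _≤_; z≤n)
  open import Data.Nat.Properties using (+-mono-≤)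
  open import Data.Fin using (Fin; zero; suc)
  open import Data.List.Properties using (map-tabulate)
  open import Data.Nat.ListAction using (sum)
  open import Function using (_∘_; id)
  open import Relation.Binary.PropositionalEquality using (_≡_; refl; cong; sym; trans)

  ∑-suc : ∀ N (f : Fin (suc N) → ℕ) → ∑ (suc N) f ≡ f zero + ∑ N (f ∘ suc)
  ∑-suc N f = cong (λ xs → f zero + sum xs) (trans (map-tabulate suc f) (sym (map-tabulate id (f ∘ suc))))

  ∑-mono-≤ : ∀ N {f g : Fin N → ℕ} → (∀ i → f i ≤ g i) → ∑ N f ≤ ∑ N g
  ∑-mono-≤ zero    f≤g = z≤n
  ∑-mono-≤ (suc N) {f} {g} f≤g rewrite ∑-suc N f | ∑-suc N g = +-mono-≤ (f≤g zero) (∑-mono-≤ N (f≤g ∘ suc))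

  ∑-const : ∀ N k → ∑ N (λ _ → k) ≡ N * k
  ∑-const zero    k = refl
  ∑-const (suc N) k = trans (∑-suc N (λ _ → k)) (cong (k +_) (∑-const N k))

module Balancing where
  open import Data.Nat as ℕ using (ℕ; zero; suc)
  open import Data.Bool using (Bool; true; false)
  open import Data.Fin using (Fin; zero; suc)
  open import Data.Vec.Functional using (_∷_)
  open import Data.Product using (Σ; _×_; _,_)
  open import Function using (_∘_)
  open import Data.Rational using (ℚ; _≤_; _+_; _-_; -_; _*_; 0ℚ; 1ℚ; _≤?_)
  open import Data.Rational.Properties
  open import Data.Rational.Solver using (module +-*-Solver)
  open import Relation.Nullary using (yes; no)
  open import Relation.Binary.PropositionalEquality using (_≡_; refl; sym; trans; cong; subst₂)
  open Embedding
  open Sums using (∑-suc)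
  open +-*-Solver

  private
    p+q-q≡p : ∀ p q → p + q - q ≡ p
    p+q-q≡p = solve 2 (λ p q → p :+ q :- q := p) refl

    p-r+q≡p+q-r : ∀ p q r → p - r + q ≡ p + q - r
    p-r+q≡p+q-r = solve 3 (λ p q r → p :- r :+ q := p :+ q :- r) refl

    p+r+q≡p+q+r : ∀ p q r → p + r + q ≡ p + q + r
    p+r+q≡p+q+r = solve 3 (λ p q r → p :+ r :+ q := p :+ q :+ r) refl

    e+[v+s]≡e+v-b+s+b : ∀ e v s b → e + (v + s) ≡ e + v - b + s + b
    e+[v+s]≡e+v-b+s+b = solve 4 (λ e v s b → e :+ (v :+ s) := e :+ v :- b :+ s :+ b) refl

    b*[1+n]≡b*n+b : ∀ b n → b * (1ℚ + n) ≡ b * n + b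
    b*[1+n]≡b*n+b = solve 2 (λ b n → b :* (con 1ℚ :+ n) := b :* n :+ b) refl

  ≈±-resp : ∀ {a a′ b b′ c : ℚ} → a ≡ a′ → b ≡ b′ → a ≈ b ± c → a′ ≈ b′ ± c
  ≈±-resp refl refl a≈b = a≈b

  ≈±-+ : ∀ {a b c : ℚ} t → a ≈ b ± c → (a + t) ≈ b + t ± c
  ≈±-+ {a} {b} {c} t (lo , hi) =
    subst₂ _≤_ (p-r+q≡p+q-r b t c) refl (+-monoˡ-≤ t lo) ,
    subst₂ _≤_ refl (p+r+q≡p+q+r b t c) (+-monoˡ-≤ t hi)

  module _ {B n : ℚ} (0≤B : 0ℚ ≤ B) (B≤n : B ≤ n) where
    open ≤-Reasoning

    Brackets : (Bool → ℕ) → Set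
    Brackets v = ℕ→ℚ (v false) ≤ B × B ≤ ℕ→ℚ (v true) × ℕ→ℚ (v true) ≤ n

    -- e is the running error (sum of the chosen values) − (number of steps) · B
    balance-step : ∀ e v → Brackets v → e ≈ 0ℚ ± n → Σ Bool λ b → (e + ℕ→ℚ (v b) - B) ≈ 0ℚ ± n
    balance-step e v (lo≤B , B≤hi , hi≤n) (0-n≤e , e≤0+n) with 0ℚ ≤? e
    ... | yes 0≤e = false ,
      (begin
        0ℚ - n              ≤⟨ +-monoʳ-≤ 0ℚ (neg-antimono-≤ B≤n) ⟩
        0ℚ - B              ≤⟨ +-monoˡ-≤ (- B) (+-mono-≤ 0≤e (ℕ→ℚ-nonNeg (v false))) ⟩
        e + lo - B          ∎) ,
      (begin
        e + lo - B          ≤⟨ +-monoˡ-≤ (- B) (+-monoʳ-≤ e lo≤B) ⟩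
        e + B - B           ≡⟨ p+q-q≡p e B ⟩
        e                   ≤⟨ e≤0+n ⟩
        0ℚ + n              ∎)
      where lo = ℕ→ℚ (v false)
    ... | no  e≱0 = true ,
      (begin
        0ℚ - n              ≤⟨ 0-n≤e ⟩
        e                   ≡⟨ p+q-q≡p e B ⟨
        e + B - B           ≤⟨ +-monoˡ-≤ (- B) (+-monoʳ-≤ e B≤hi) ⟩
        e + hi - B          ∎) ,
      (begin
        e + hi - B          ≤⟨ +-monoˡ-≤ (- B) (+-monoˡ-≤ hi (<⇒≤ (≰⇒> e≱0))) ⟩
        0ℚ + hi - B         ≤⟨ +-monoʳ-≤ (0ℚ + hi) (neg-antimono-≤ 0≤B) ⟩
        0ℚ + hi - 0ℚ        ≡⟨ +-identityʳ (0ℚ + hi) ⟩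
        0ℚ + hi             ≤⟨ +-monoʳ-≤ 0ℚ hi≤n ⟩
        0ℚ + n              ∎)
      where hi = ℕ→ℚ (v true)

    balance-from : ∀ N (V : Fin N → Bool → ℕ) → (∀ j → Brackets (V j)) →
                   ∀ e → e ≈ 0ℚ ± n → Σ (Fin N → Bool) λ ch → (e + ℕ→ℚ (∑ N λ j → V j (ch j))) ≈ B * ℕ→ℚ N ± n
    balance-from zero V V-brackets e e≈0 =
      (λ ()) , ≈±-resp (sym (+-identityʳ e)) (sym (*-zeroʳ B)) e≈0
    balance-from (suc N) V V-brackets e e≈0 =
      let b , e′≈0 = balance-step e (V zero) (V-brackets zero) e≈0
          ch , rest = balance-from N (V ∘ suc) (V-brackets ∘ suc) (e + ℕ→ℚ (V zero b) - B) e′≈0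
      in  b ∷ ch , ≈±-resp (sym (sum≡ b ch)) (sym steps) (≈±-+ {b = B * ℕ→ℚ N} B rest)
      where
        sum≡ : ∀ b ch → let S = ∑ N λ j → V (suc j) (ch j) in
               e + ℕ→ℚ (∑ (suc N) λ j → V j ((b ∷ ch) j)) ≡ e + ℕ→ℚ (V zero b) - B + ℕ→ℚ S + B
        sum≡ b ch = begin-equality
          e + ℕ→ℚ (∑ (suc N) λ j → V j ((b ∷ ch) j))  ≡⟨ cong (λ k → e + ℕ→ℚ k) (∑-suc N (λ j → V j ((b ∷ ch) j))) ⟩
          e + ℕ→ℚ (V zero b ℕ.+ S)                    ≡⟨ cong (e +_) (ℕ→ℚ-+ (V zero b) S) ⟩
          e + (ℕ→ℚ (V zero b) + ℕ→ℚ S)                ≡⟨ e+[v+s]≡e+v-b+s+b e (ℕ→ℚ (V zero b)) (ℕ→ℚ S) B ⟩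
          e + ℕ→ℚ (V zero b) - B + ℕ→ℚ S + B          ∎
          where
            S : ℕ
            S = ∑ N λ j → V (suc j) (ch j)

        steps : B * ℕ→ℚ (suc N) ≡ B * ℕ→ℚ N + B
        steps = trans (cong (B *_) (ℕ→ℚ-+ 1 N)) (b*[1+n]≡b*n+b B (ℕ→ℚ N))

    balance : ∀ N (V : Fin N → Bool → ℕ) → (∀ j → Brackets (V j)) →
              Σ (Fin N → Bool) λ ch → ℕ→ℚ (∑ N λ j → V j (ch j)) ≈ B * ℕ→ℚ N ± n
    balance N V V-brackets =
      let ch , sum≈ = balance-from N V V-brackets 0ℚ 0≈0±n
      in  ch , ≈±-resp {b = B * ℕ→ℚ N} (+-identityˡ (ℕ→ℚ (∑ N λ j → V j (ch j)))) refl sum≈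
      where
        0≤n : 0ℚ ≤ n
        0≤n = ≤-trans 0≤B B≤n
        0≈0±n : 0ℚ ≈ 0ℚ ± n
        0≈0±n = +-monoʳ-≤ 0ℚ (neg-antimono-≤ 0≤n) , +-monoʳ-≤ 0ℚ 0≤n

module Hierarchy where
  open import Data.Integer using (+_)
  open import Data.Rational using (ℚ; _/_; _≤_; _<_; _*_; _⊔_; 0ℚ; _≤?_; _<?_; nonNegative)
  open import Data.Rational.Properties
  open import Relation.Nullary.Decidable using (toWitness)
  open import Relation.Binary.PropositionalEquality using (_≡_; cong)
  open Powers

  κ : ℚ
  κ = + 1 / 64

  -- arguments are clamped at 0 so that f and g are non-decreasing on all of ℚ
  f g : ℚ → ℚ
  f x = κ * (0ℚ ⊔ x) ^ 6
  g x = (0ℚ ⊔ x) * (0ℚ ⊔ x)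

  0≤κ : 0ℚ ≤ κ
  0≤κ = toWitness {a? = 0ℚ ≤? κ} _

  f-mono : NonDecreasing f
  f-mono x y x≤y = *-monoˡ-≤-nonNeg κ {{nonNegative 0≤κ}} (^-mono-≤ 6 (p≤p⊔q 0ℚ x) (⊔-monoʳ-≤ 0ℚ x≤y))

  g-mono : NonDecreasing g
  g-mono x y x≤y = *-mono-≤-nonNeg (p≤p⊔q 0ℚ x) (p≤p⊔q 0ℚ x) (⊔-monoʳ-≤ 0ℚ x≤y) (⊔-monoʳ-≤ 0ℚ x≤y)

  clamp-pos : ∀ {x} → 0ℚ < x → 0ℚ ⊔ x ≡ x
  clamp-pos 0<x = p≤q⇒p⊔q≡q (<⇒≤ 0<x)

  f-on-pos : ∀ {x} → 0ℚ < x → f x ≡ κ * x ^ 6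
  f-on-pos 0<x = cong (λ y → κ * y ^ 6) (clamp-pos 0<x)

  g-on-pos : ∀ {x} → 0ℚ < x → g x ≡ x * x
  g-on-pos 0<x = cong (λ y → y * y) (clamp-pos 0<x)

  f-pos : PositiveOnPositive f
  f-pos x 0<x rewrite f-on-pos 0<x = *-pos (toWitness {a? = 0ℚ <? κ} _) (^-pos 6 0<x)

  g-pos : PositiveOnPositive g
  g-pos x 0<x rewrite g-on-pos 0<x = *-pos 0<x 0<x

module Estimates where
  open import Data.Nat as ℕ using (ℕ; suc; NonZero; >-nonZero⁻¹)
  open import Data.Integer using (+_)
  open import Data.Rational using (ℚ; _/_; _≤_; _<_; _+_; _*_; 0ℚ; 1ℚ; _≤?_; nonNegative; positive)
  open import Data.Rational.Properties
  open import Data.Rational.Solver using (module +-*-Solver)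
  open import Relation.Nullary.Decidable using (toWitness)
  open import Relation.Binary.PropositionalEquality using (_≡_; refl; sym; cong; subst)
  open Embedding
  open Powers
  open Hierarchy using (κ; 0≤κ)
  open +-*-Solver

  module Bounds (Δ n : ℕ) .{{_ : NonZero Δ}} .{{_ : NonZero n}} (α β : ℚ) (0<α : 0ℚ < α) (0<β : 0ℚ < β)
           (α≤1/Δ : α ≤ + 1 / Δ) (β≤κα⁶ : β ≤ κ * α ^ 6) (1/n≤β² : + 1 / n ≤ β * β) where

    private
      D N βn : ℚ
      D  = ℕ→ℚ Δ
      N  = ℕ→ℚ n
      βn = β * N
      0≤α : 0ℚ ≤ α
      0≤α = <⇒≤ 0<α
      0≤β : 0ℚ ≤ β
      0≤β = <⇒≤ 0<β
      0≤D : 0ℚ ≤ D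
      0≤D = ℕ→ℚ-nonNeg Δ
      0≤N : 0ℚ ≤ N
      0≤N = ℕ→ℚ-nonNeg n
      open ≤-Reasoning

    αΔ≤1 : α * D ≤ 1ℚ
    αΔ≤1 = ≤-trans (*-monoʳ-≤-nonNeg D {{nonNegative 0≤D}} α≤1/Δ) (≤-reflexive (1/n*n≡1 Δ))

    α≤1 : α ≤ 1ℚ
    α≤1 = begin
      α        ≡⟨ *-identityʳ α ⟨
      α * 1ℚ   ≤⟨ *-monoˡ-≤-nonNeg α {{nonNegative 0≤α}} (ℕ→ℚ-mono-≤ (>-nonZero⁻¹ Δ)) ⟩
      α * D    ≤⟨ αΔ≤1 ⟩
      1ℚ       ∎

    β≤1 : β ≤ 1ℚ
    β≤1 = begin
      β             ≤⟨ β≤κα⁶ ⟩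
      κ * α ^ 6     ≤⟨ *-monoˡ-≤-nonNeg κ {{nonNegative 0≤κ}} (^-mono-≤ 6 0≤α α≤1) ⟩
      κ * 1ℚ ^ 6    ≤⟨ toWitness {a? = κ * 1ℚ ^ 6 ≤? 1ℚ} _ ⟩
      1ℚ            ∎

    1≤β*βn : 1ℚ ≤ β * βn
    1≤β*βn = begin
      1ℚ              ≡⟨ 1/n*n≡1 n ⟨
      (+ 1 / n) * N   ≤⟨ *-monoʳ-≤-nonNeg N {{nonNegative 0≤N}} 1/n≤β² ⟩
      (β * β) * N     ≡⟨ *-assoc β β N ⟩
      β * βn          ∎

    βn≤n : βn ≤ N
    βn≤n = ≤-trans (*-monoʳ-≤-nonNeg N {{nonNegative 0≤N}} β≤1) (≤-reflexive (*-identityˡ N))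

    Δ+1≤βn : ℕ→ℚ (suc Δ) ≤ βn
    Δ+1≤βn = *-cancelˡ-≤-pos β {{positive 0<β}} (begin
      β * ℕ→ℚ (suc Δ)                 ≡⟨ cong (β *_) (ℕ→ℚ-+ 1 Δ) ⟩
      β * (1ℚ + D)                    ≤⟨ *-monoˡ-≤-nonNeg β {{nonNegative 0≤β}} (+-monoˡ-≤ D (ℕ→ℚ-mono-≤ (>-nonZero⁻¹ Δ))) ⟩
      β * (D + D)                     ≤⟨ *-monoʳ-≤-nonNeg (D + D) {{nonNegative (+-mono-≤ 0≤D 0≤D)}} β≤κα⁶ ⟩
      (κ * α ^ 6) * (D + D)
        ≡⟨ solve 3 (λ k a D → (k :* a :^ 6) :* (D :+ D) := (k :+ k) :* ((a :* D) :* a :^ 5)) refl κ α D ⟩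
      (κ + κ) * ((α * D) * α ^ 5)
        ≤⟨ *-monoˡ-≤-nonNeg (κ + κ) {{nonNegative (+-mono-≤ 0≤κ 0≤κ)}}
             (*-mono-≤-nonNeg (*-nonNeg 0≤α 0≤D) (^-nonNeg 5 0≤α) αΔ≤1 (^-mono-≤ 5 0≤α α≤1)) ⟩
      (κ + κ) * (1ℚ * 1ℚ ^ 5)         ≤⟨ toWitness {a? = (κ + κ) * (1ℚ * 1ℚ ^ 5) ≤? 1ℚ} _ ⟩
      1ℚ                              ≤⟨ 1≤β*βn ⟩
      β * βn                          ∎)

    0<βn : 0ℚ < βn
    0<βn = <-≤-trans (ℕ→ℚ-mono-< (ℕ.z<s {Δ})) Δ+1≤βn

    [Δ+1]α≤2 : ℕ→ℚ (suc Δ) * α ≤ + 2 / 1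
    [Δ+1]α≤2 = begin
      ℕ→ℚ (suc Δ) * α   ≡⟨ cong (_* α) (ℕ→ℚ-+ 1 Δ) ⟩
      (1ℚ + D) * α      ≤⟨ *-monoʳ-≤-nonNeg α {{nonNegative 0≤α}} (+-monoˡ-≤ D (ℕ→ℚ-mono-≤ (>-nonZero⁻¹ Δ))) ⟩
      (D + D) * α       ≡⟨ solve 2 (λ D a → (D :+ D) :* a := a :* D :+ a :* D) refl D α ⟩
      α * D + α * D     ≤⟨ +-mono-≤ αΔ≤1 αΔ≤1 ⟩
      + 2 / 1           ∎

    [Δ+1]⁵[βn+1]<αn : ℕ→ℚ (suc Δ ℕ.^ 5) * (βn + 1ℚ) < α * N
    [Δ+1]⁵[βn+1]<αn = subst (_< α * N) (cong (_* (βn + 1ℚ)) (sym (ℕ→ℚ-^ (suc Δ) 5)))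
      (*-cancelʳ-<-nonNeg (α ^ 5) {{nonNegative (^-nonNeg 5 0≤α)}} (begin-strict
        E ^ 5 * (βn + 1ℚ) * α ^ 5      ≡⟨ regroup E (βn + 1ℚ) α ⟩
        (E * α) ^ 5 * (βn + 1ℚ)        ≤⟨ *-monoʳ-≤-nonNeg (βn + 1ℚ) {{nonNegative 0≤βn+1}} (^-mono-≤ 5 0≤Eα [Δ+1]α≤2) ⟩
        32ℚ * (βn + 1ℚ)                ≡⟨ *-distribˡ-+ 32ℚ βn 1ℚ ⟩
        32ℚ * βn + 32ℚ * 1ℚ            <⟨ +-monoʳ-< (32ℚ * βn) (*-monoʳ-<-pos 32ℚ 1<βn) ⟩
        32ℚ * βn + 32ℚ * βn            ≡⟨ double β N ⟩
        64ℚ * β * N                    ≤⟨ *-monoʳ-≤-nonNeg N {{nonNegative 0≤N}} (*-monoˡ-≤-nonNeg 64ℚ β≤κα⁶) ⟩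
        64ℚ * (κ * α ^ 6) * N          ≡⟨ cancel-κ α N ⟩
        α * N * α ^ 5                  ∎))
      where
        open ≤-Reasoning
        E 32ℚ 64ℚ : ℚ
        E   = ℕ→ℚ (suc Δ)
        32ℚ = + 32 / 1
        64ℚ = + 64 / 1
        0≤Eα : 0ℚ ≤ E * α
        0≤Eα = *-nonNeg (ℕ→ℚ-nonNeg (suc Δ)) 0≤α
        0≤βn+1 : 0ℚ ≤ βn + 1ℚ
        0≤βn+1 = +-mono-≤ (<⇒≤ 0<βn) (ℕ→ℚ-nonNeg 1)
        1<βn : 1ℚ < βn
        1<βn = <-≤-trans (ℕ→ℚ-mono-< (ℕ.s<s (>-nonZero⁻¹ Δ))) Δ+1≤βn
        regroup : ∀ x y z → x ^ 5 * y * z ^ 5 ≡ (x * z) ^ 5 * y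
        regroup = solve 3 (λ x y z → x :^ 5 :* y :* z :^ 5 := (x :* z) :^ 5 :* y) refl
        double : ∀ x y → 32ℚ * (x * y) + 32ℚ * (x * y) ≡ 64ℚ * x * y
        double = solve 2 (λ x y → con 32ℚ :* (x :* y) :+ con 32ℚ :* (x :* y) := con 64ℚ :* x :* y) refl
        cancel-κ : ∀ x y → 64ℚ * (κ * x ^ 6) * y ≡ x * y * x ^ 5
        cancel-κ = solve 2 (λ x y → con 64ℚ :* (con κ :* x :^ 6) :* y := x :* y :* x :^ 5) refl

module Arithmetic where
  open import Data.Nat using (ℕ; suc; _+_; _*_; _≤_; _<_; s≤s)
  open import Data.Nat.Properties
  open import Data.Nat.DivMod using (_/_; _%_; m/n*n≤m; m≡m%n+[m/n]*n; m%n<n)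
  open import Data.Product using (Σ; _×_; _,_)
  open import Relation.Binary.PropositionalEquality using (cong)

  floor-quotient : ∀ m c → 0 < c → Σ ℕ λ L → c * L ≤ m × m < c * suc L
  floor-quotient m c@(suc _) _ = m / c , ≤-trans (≤-reflexive (*-comm c (m / c))) (m/n*n≤m m c) , m<c[1+m/c]
    where
      m<c[1+m/c] : m < c * suc (m / c)
      m<c[1+m/c] = begin-strict
        m                  ≡⟨ m≡m%n+[m/n]*n m c ⟩
        m % c + m / c * c  <⟨ +-monoˡ-< (m / c * c) (m%n<n m c) ⟩
        c + m / c * c      ≡⟨ cong (c +_) (*-comm (m / c) c) ⟩
        c + c * (m / c)    ≡⟨ *-suc c (m / c) ⟨
        c * suc (m / c)    ∎
        where open ≤-Reasoning

  1+d[1+L]≤[1+d]m : ∀ d L m → L ≤ m → suc d ≤ m → suc (d * suc L) ≤ suc d * m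
  1+d[1+L]≤[1+d]m d L m L≤m 1+d≤m = begin
    suc (d * suc L)  ≤⟨ s≤s (*-monoʳ-≤ d (s≤s L≤m)) ⟩
    suc (d * suc m)  ≡⟨ cong suc (*-suc d m) ⟩
    suc d + d * m    ≤⟨ +-monoˡ-≤ (d * m) 1+d≤m ⟩
    m + d * m        ∎
    where open ≤-Reasoning

module Components where
  open import Data.Nat using (zero; suc; _+_; _≤_; z≤n; s≤s)
  open import Data.Nat.Properties using (≤-reflexive; +-identityʳ; +-monoʳ-≤)
  open import Data.Fin using (toℕ)
  open import Data.Sum using (_⊎_; inj₁; inj₂)
  open import Relation.Binary.PropositionalEquality using (_≡_; refl; cong)

  1⊎2⇒1≤ : ∀ {c} → c ≡ 1 ⊎ c ≡ 2 → 1 ≤ c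
  1⊎2⇒1≤ (inj₁ refl) = s≤s z≤n
  1⊎2⇒1≤ (inj₂ refl) = s≤s z≤n

  1⊎2⇒≤2 : ∀ {c} → c ≡ 1 ⊎ c ≡ 2 → c ≤ 2
  1⊎2⇒≤2 (inj₁ refl) = s≤s z≤n
  1⊎2⇒≤2 (inj₂ refl) = s≤s (s≤s z≤n)

  comp-elim : ∀ (P : Tree → Set) F k → P (Forest.K₁ F) → P (Forest.K₂ F) → P (comp F k)
  comp-elim P F zero    p₁ p₂ = p₁
  comp-elim P F (suc k) p₁ p₂ = p₂

  ∑-size-comp≤order : ∀ c → c ≤ 2 → ∀ F → ∑ c (λ i → size (comp F (toℕ i))) ≤ order F
  ∑-size-comp≤order 0       _ F = z≤n
  ∑-size-comp≤order 1       _ F = +-monoʳ-≤ (size (Forest.K₁ F)) z≤n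
  ∑-size-comp≤order 2       _ F = ≤-reflexive (cong (size (Forest.K₁ F) +_) (+-identityʳ (size (Forest.K₂ F))))
  ∑-size-comp≤order (suc (suc (suc _))) (s≤s (s≤s ())) F

module Ceiling where
  open import Data.Nat as ℕ using (ℕ; zero; suc)
  import Data.Nat.Properties as ℕ
  open import Data.Rational using (_≤_; _<_; 0ℚ; _≤?_)
  open import Data.Rational.Properties using (≰⇒>; <-≤-trans; <-irrefl)
  open import Data.Product using (Σ; _×_; _,_)
  open import Data.Empty using (⊥-elim)
  open import Relation.Nullary using (yes; no)
  open import Relation.Binary.PropositionalEquality using (refl; subst)

  ceiling-bracket : ∀ q K → 0ℚ < q → q ≤ ℕ→ℚ K → Σ ℕ λ m → ℕ→ℚ m < q × q ≤ ℕ→ℚ (suc m)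
  ceiling-bracket q K 0<q q≤K = search K 0 0<q q≤K
    where
      search : ∀ fuel k → ℕ→ℚ k < q → q ≤ ℕ→ℚ (k ℕ.+ fuel) → Σ ℕ λ m → ℕ→ℚ m < q × q ≤ ℕ→ℚ (suc m)
      search fuel k k<q q≤k+fuel with q ≤? ℕ→ℚ (suc k)
      ... | yes q≤1+k = k , k<q , q≤1+k
      search zero    k k<q q≤k | no _ =
        ⊥-elim (<-irrefl refl (<-≤-trans k<q (subst (λ t → q ≤ ℕ→ℚ t) (ℕ.+-identityʳ k) q≤k)))
      search (suc f) k k<q q≤k+fuel | no q≰1+k =
        search f (suc k) (≰⇒> q≰1+k) (subst (λ t → q ≤ ℕ→ℚ t) (ℕ.+-suc k f) q≤k+fuel)

module MainArgument where
  open import Data.Nat as ℕ using (ℕ; suc; NonZero; z<s; s≤s; >-nonZero)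
  import Data.Nat.Properties as ℕ
  open import Data.Integer using (+_)
  open import Data.Rational using (ℚ; _/_; _≤_; _<_; _+_; _*_; 0ℚ; 1ℚ; ½; _≤?_; nonNegative)
  open import Data.Rational.Properties
  open import Data.Rational.Solver using (module +-*-Solver)
  open import Data.Fin using (Fin; toℕ)
  open import Data.Bool using (Bool; true; false)
  open import Data.Maybe using (just)
  open import Data.Product using (Σ; _×_; _,_; proj₁; proj₂)
  open import Data.Sum using (_⊎_)
  open import Relation.Binary.PropositionalEquality using (_≡_; refl; trans; cong)
  open import Relation.Nullary.Decidable using (toWitness)
  open Subtrees
  open Powers using (_^_; *-nonNeg)
  open Embedding
  open Hierarchy using (κ)
  open Sums
  open Balancing
  open Arithmetic
  open Components
  open Ceiling
  open +-*-Solver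

  module Construction (d n : ℕ) .{{_ : NonZero n}} (α β : ℚ) (0<α : 0ℚ < α) (0<β : 0ℚ < β)
           (α≤1/Δ : α ≤ + 1 / suc d) (β≤κα⁶ : β ≤ κ * α ^ 6) (1/n≤β² : + 1 / n ≤ β * β)
           (c : ℕ) (c≡1⊎2 : c ≡ 1 ⊎ c ≡ 2) (N : ℕ) (𝓕 : Fin N → Forest)
           (K₁-large : ∀ j → α * ℕ→ℚ n ≤ ℕ→ℚ (size (Forest.K₁ (𝓕 j))))
           (K₂-large : ∀ j → α * ℕ→ℚ n ≤ ℕ→ℚ (size (Forest.K₂ (𝓕 j))))
           (order≤n : ∀ j → order (𝓕 j) ℕ.≤ n)
           (maxdeg : ∀ j → MaxDegF≤ (𝓕 j) (suc d)) where

    open Estimates.Bounds (suc d) n α β 0<α 0<β α≤1/Δ β≤κα⁶ 1/n≤β²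

    1≤c : 1 ℕ.≤ c
    1≤c = 1⊎2⇒1≤ c≡1⊎2

    c≤2 : c ℕ.≤ 2
    c≤2 = 1⊎2⇒≤2 c≡1⊎2

    D βn : ℚ
    D  = ℕ→ℚ (suc d)
    βn = β * ℕ→ℚ n

    K : Fin N → Fin c → Tree
    K j i = comp (𝓕 j) (toℕ i)

    bracket : Σ ℕ λ m → ℕ→ℚ m < βn × βn ≤ ℕ→ℚ (suc m)
    bracket = ceiling-bracket βn n 0<βn βn≤n

    m : ℕ
    m = proj₁ bracket

    m<βn : ℕ→ℚ m < βn
    m<βn = proj₁ (proj₂ bracket)

    βn≤1+m : βn ≤ ℕ→ℚ (suc m)
    βn≤1+m = proj₂ (proj₂ bracket)

    1+d≤m : suc d ℕ.≤ m
    1+d≤m = ℕ.≤-pred (ℕ→ℚ-cancel-≤ (≤-trans Δ+1≤βn βn≤1+m))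

    quotient : Σ ℕ λ L → c ℕ.* L ℕ.≤ m × m ℕ.< c ℕ.* suc L
    quotient = floor-quotient m c 1≤c

    L : ℕ
    L = proj₁ quotient

    cL≤m : c ℕ.* L ℕ.≤ m
    cL≤m = proj₁ (proj₂ quotient)

    m<c[1+L] : m ℕ.< c ℕ.* suc L
    m<c[1+L] = proj₂ (proj₂ quotient)

    L≤m : L ℕ.≤ m
    L≤m = ℕ.≤-trans (ℕ.m≤n*m L c {{>-nonZero 1≤c}}) cL≤m

    [Δ+1]⁵[1+L]<size : ∀ j i → suc (suc d) ℕ.^ 5 ℕ.* suc L ℕ.< size (K j i)
    [Δ+1]⁵[1+L]<size j i = ℕ→ℚ-cancel-< (begin-strict
      ℕ→ℚ (P ℕ.* suc L)        ≡⟨ ℕ→ℚ-* P (suc L) ⟩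
      ℕ→ℚ P * ℕ→ℚ (suc L)      ≤⟨ *-monoˡ-≤-nonNeg (ℕ→ℚ P) {{nonNegative (ℕ→ℚ-nonNeg P)}} 1+L≤βn+1 ⟩
      ℕ→ℚ P * (βn + 1ℚ)        <⟨ [Δ+1]⁵[βn+1]<αn ⟩
      α * ℕ→ℚ n                ≤⟨ comp-elim (λ K → α * ℕ→ℚ n ≤ ℕ→ℚ (size K)) (𝓕 j) (toℕ i)
                                    (K₁-large j) (K₂-large j) ⟩
      ℕ→ℚ (size (K j i))       ∎)
      where
        open ≤-Reasoning
        P : ℕ
        P = suc (suc d) ℕ.^ 5
        1+L≤βn+1 : ℕ→ℚ (suc L) ≤ βn + 1ℚ
        1+L≤βn+1 = begin
          ℕ→ℚ (suc L)    ≤⟨ ℕ→ℚ-mono-≤ (s≤s L≤m) ⟩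
          ℕ→ℚ (1 ℕ.+ m)  ≡⟨ ℕ→ℚ-+ 1 m ⟩
          1ℚ + ℕ→ℚ m     ≤⟨ +-monoʳ-≤ 1ℚ (<⇒≤ m<βn) ⟩
          1ℚ + βn        ≡⟨ +-comm 1ℚ βn ⟩
          βn + 1ℚ        ∎

    straddles : ∀ j i → Σ (Straddle d (suc L) (K j i)) λ S → ∀ b → FarFromRoot 5 (K j i) (Straddle.pos S b)
    straddles j i = straddle-far-from-root 4 (K j i) z<s
      (comp-elim (λ K → MaxDeg≤ K (suc d)) (𝓕 j) (toℕ i) (proj₁ (maxdeg j)) (proj₂ (maxdeg j)))
      ([Δ+1]⁵[1+L]<size j i)

    candidate : Fin N → Fin c → Bool → Tree
    candidate j i = Straddle.sub (proj₁ (straddles j i))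

    option-edges : Fin N → Bool → ℕ
    option-edges j b = ∑ c λ i → edges (candidate j i b)

    option-edges-light≤m : ∀ j → option-edges j false ℕ.≤ m
    option-edges-light≤m j = begin
      option-edges j false       ≤⟨ ∑-mono-≤ c (λ i → edges-light≤ (proj₁ (straddles j i))) ⟩
      ∑ c (λ _ → L)   ≡⟨ ∑-const c L ⟩
      c ℕ.* L         ≤⟨ cL≤m ⟩
      m               ∎
      where open ℕ.≤-Reasoning

    m<option-edges-heavy : ∀ j → m ℕ.< option-edges j true
    m<option-edges-heavy j = begin-strict
      m                   <⟨ m<c[1+L] ⟩
      c ℕ.* suc L         ≡⟨ ∑-const c (suc L) ⟨
      ∑ c (λ _ → suc L)   ≤⟨ ∑-mono-≤ c (λ i → <edges-heavy (proj₁ (straddles j i))) ⟩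
      option-edges j true            ∎
      where open ℕ.≤-Reasoning

    option-edges-heavy≤n : ∀ j → option-edges j true ℕ.≤ n
    option-edges-heavy≤n j = begin
      option-edges j true                                  ≤⟨ ∑-mono-≤ c (λ i → edges-heavy≤size (proj₁ (straddles j i))) ⟩
      ∑ c (λ i → size (comp (𝓕 j) (toℕ i)))     ≤⟨ ∑-size-comp≤order c c≤2 (𝓕 j) ⟩
      order (𝓕 j)                               ≤⟨ order≤n j ⟩
      n                                         ∎
      where open ℕ.≤-Reasoning

    balanced : Σ (Fin N → Bool) λ ch → ℕ→ℚ (∑ N λ j → option-edges j (ch j)) ≈ βn * ℕ→ℚ N ± ℕ→ℚ n
    balanced = balance (<⇒≤ 0<βn) βn≤n N option-edges λ j →
      ≤-trans (ℕ→ℚ-mono-≤ (option-edges-light≤m j)) (<⇒≤ m<βn) ,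
      ≤-trans βn≤1+m (ℕ→ℚ-mono-≤ (m<option-edges-heavy j)) ,
      ℕ→ℚ-mono-≤ (option-edges-heavy≤n j)

    choice : Fin N → Bool
    choice = proj₁ balanced

    y : Fin N → Fin c → Pos
    y j i = Straddle.pos (proj₁ (straddles j i)) (choice j)

    T : Fin N → Fin c → Tree
    T j i = candidate j i (choice j)

    1+m≤2[1+d]size : ∀ j i → suc m ℕ.≤ 2 ℕ.* (suc d ℕ.* size (T j i))
    1+m≤2[1+d]size j i = begin
      suc m                       ≤⟨ m<c[1+L] ⟩
      c ℕ.* suc L                 ≤⟨ ℕ.*-monoˡ-≤ (suc L) c≤2 ⟩
      2 ℕ.* suc L                 ≤⟨ ℕ.*-monoʳ-≤ 2 (M≤[1+D]*size-sub (proj₁ (straddles j i)) (choice j)) ⟩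
      2 ℕ.* (suc d ℕ.* size (T j i)) ∎
      where open ℕ.≤-Reasoning

    size≤[1+d]m : ∀ j i → size (T j i) ℕ.≤ suc d ℕ.* m
    size≤[1+d]m j i =
      ℕ.≤-trans (size-sub≤1+D*M (proj₁ (straddles j i)) (choice j)) (1+d[1+L]≤[1+d]m d L m L≤m 1+d≤m)

    size-lower : ∀ j i → (+ 1 / suc d) * β * ℕ→ℚ n * ½ ≤ ℕ→ℚ (size (T j i))
    size-lower j i = begin
      (+ 1 / suc d) * β * ℕ→ℚ n * ½
        ≡⟨ solve 4 (λ u b N h → u :* b :* N :* h := (u :* h) :* (b :* N)) refl (+ 1 / suc d) β (ℕ→ℚ n) ½ ⟩
      ((+ 1 / suc d) * ½) * βn
        ≤⟨ *-monoˡ-≤-nonNeg ((+ 1 / suc d) * ½) {{nonNegative 0≤u/2}}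
             (≤-trans βn≤1+m (ℕ→ℚ-mono-≤ (1+m≤2[1+d]size j i))) ⟩
      ((+ 1 / suc d) * ½) * ℕ→ℚ (2 ℕ.* (suc d ℕ.* s))
        ≡⟨ cong (((+ 1 / suc d) * ½) *_)
             (trans (ℕ→ℚ-* 2 (suc d ℕ.* s)) (cong (ℕ→ℚ 2 *_) (ℕ→ℚ-* (suc d) s))) ⟩
      ((+ 1 / suc d) * ½) * (ℕ→ℚ 2 * (D * ℕ→ℚ s))
        ≡⟨ solve 5 (λ u h t D S → (u :* h) :* (t :* (D :* S)) := (u :* D) :* (h :* t) :* S)
                   refl (+ 1 / suc d) ½ (ℕ→ℚ 2) D (ℕ→ℚ s) ⟩
      ((+ 1 / suc d) * D) * (½ * ℕ→ℚ 2) * ℕ→ℚ s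
        ≡⟨ cong (λ z → z * (½ * ℕ→ℚ 2) * ℕ→ℚ s) (1/n*n≡1 (suc d)) ⟩
      1ℚ * (½ * ℕ→ℚ 2) * ℕ→ℚ s
        ≡⟨⟩
      1ℚ * 1ℚ * ℕ→ℚ s
        ≡⟨ solve 1 (λ S → con 1ℚ :* con 1ℚ :* S := S) refl (ℕ→ℚ s) ⟩
      ℕ→ℚ s ∎
      where
        open ≤-Reasoning
        s : ℕ
        s = size (T j i)
        0≤u/2 : 0ℚ ≤ (+ 1 / suc d) * ½
        0≤u/2 = *-nonNeg (≤-trans (<⇒≤ 0<α) α≤1/Δ) (toWitness {a? = 0ℚ ≤? ½} _)

    size-upper : ∀ j i → ℕ→ℚ (size (T j i)) ≤ D * β * ℕ→ℚ n
    size-upper j i = begin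
      ℕ→ℚ (size (T j i))  ≤⟨ ℕ→ℚ-mono-≤ (size≤[1+d]m j i) ⟩
      ℕ→ℚ (suc d ℕ.* m)   ≡⟨ ℕ→ℚ-* (suc d) m ⟩
      D * ℕ→ℚ m           ≤⟨ *-monoˡ-≤-nonNeg D {{nonNegative (ℕ→ℚ-nonNeg (suc d))}} (<⇒≤ m<βn) ⟩
      D * βn              ≡⟨ *-assoc D β (ℕ→ℚ n) ⟨
      D * β * ℕ→ℚ n       ∎
      where open ≤-Reasoning

    subforests :
      Σ (Fin N → Fin c → Pos) λ y → Σ (Fin N → Fin c → Tree) λ T →
        (∀ j i → comp (𝓕 j) (toℕ i) at y j i ≡ just (T j i)) ×
        (∀ j i → FarFromRoot 5 (comp (𝓕 j) (toℕ i)) (y j i)) ×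
        (∀ j i → (+ 1 / suc d) * β * ℕ→ℚ n * ½ ≤ ℕ→ℚ (size (T j i))) ×
        (∀ j i → ℕ→ℚ (size (T j i)) ≤ D * β * ℕ→ℚ n) ×
        (ℕ→ℚ (∑ N λ j → ∑ c λ i → edges (T j i)) ≈ β * ℕ→ℚ n * ℕ→ℚ N ± ℕ→ℚ n)
    subforests =
      y , T ,
      (λ j i → Straddle.at-pos (proj₁ (straddles j i)) (choice j)) ,
      (λ j i → proj₂ (straddles j i) (choice j)) ,
      size-lower , size-upper , proj₂ balanced

open import Data.Nat using (ℕ; NonZero; zero; suc)
open import Data.Integer using (+_)
open import Data.Rational using (ℚ; _/_; _≤_; _<_; _*_; 0ℚ; ½)
open import Data.Fin using (Fin; toℕ)
open import Data.Maybe using (just)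
open import Data.Product using (Σ; _×_; _,_)
open import Data.Sum using (_⊎_)
open import Relation.Binary.PropositionalEquality using (_≡_; subst)

open Hierarchy using (f; g; f-mono; g-mono; f-pos; g-pos; f-on-pos; g-on-pos)
open MainArgument using (module Construction)

proposition6p4 :
  Σ (ℚ → ℚ) λ f → Σ (ℚ → ℚ) λ g →
  NonDecreasing f × NonDecreasing g × PositiveOnPositive f × PositiveOnPositive g ×
  ((Δ n : ℕ) .{{_ : NonZero Δ}} .{{_ : NonZero n}} (α β : ℚ) →
   0ℚ < α → 0ℚ < β → α ≤ + 1 / Δ → β ≤ f α → + 1 / n ≤ g β →
   (c : ℕ) → (c ≡ 1 ⊎ c ≡ 2) →
   (N : ℕ) (𝓕 : Fin N → Forest) →
   (∀ j → α * ℕ→ℚ n ≤ ℕ→ℚ (size (Forest.K₁ (𝓕 j)))) →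
   (∀ j → α * ℕ→ℚ n ≤ ℕ→ℚ (size (Forest.K₂ (𝓕 j)))) →
   (∀ j → order (𝓕 j) Data.Nat.≤ n) →
   (∀ j → MaxDegF≤ (𝓕 j) Δ) →
   Σ (Fin N → Fin c → Pos) λ y → Σ (Fin N → Fin c → Tree) λ T →
     (∀ j i → comp (𝓕 j) (toℕ i) at y j i ≡ just (T j i)) ×
     (∀ j i → FarFromRoot 5 (comp (𝓕 j) (toℕ i)) (y j i)) ×
     (∀ j i → (+ 1 / Δ) * β * ℕ→ℚ n * ½ ≤ ℕ→ℚ (size (T j i))) ×
     (∀ j i → ℕ→ℚ (size (T j i)) ≤ ℕ→ℚ Δ * β * ℕ→ℚ n) ×
     (ℕ→ℚ (∑ N λ j → ∑ c λ i → edges (T j i)) ≈ β * ℕ→ℚ n * ℕ→ℚ N ± ℕ→ℚ n))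
proposition6p4 = f , g , f-mono , g-mono , f-pos , g-pos , λ where
  zero _ {{()}}
  (suc d) n α β 0<α 0<β α≤1/Δ β≤fα 1/n≤gβ c c≡1⊎2 N 𝓕 K₁-large K₂-large order≤n maxdeg →
    Construction.subforests d n α β 0<α 0<β α≤1/Δ
      (subst (β ≤_) (f-on-pos 0<α) β≤fα)
      (subst (+ 1 / n ≤_) (g-on-pos 0<β) 1/n≤gβ)
      c c≡1⊎2 N 𝓕 K₁-large K₂-large order≤n maxdeg
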